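{- Let $q$ be a power of an odd prime, let $X_1,\dots,X_4$ be homogeneous coordinates of ${\rm PG}(3,q)$ and $U_i$ the point with $1$ in position $i$ and $0$ elsewhere. For $\lambda\in{\rm GF}(q)$ let $\mathcal Q_\lambda$ be the quadric $X_1X_3-X_2^2+\lambda X_4^2=0$ (a cone with vertex $U_4$ if $\lambda=0$, hyperbolic if $\lambda$ is a non-zero square, elliptic if $\lambda$ is a non-square), let $\pi$ be the plane $X_4=0$, $\mathcal C=\{(1,t,t^2,0): t\in{\rm GF}(q)\}\cup\{U_3\}$, and let $\mathcal E$ be the set of points of $\pi$ external to $\mathcal C$. Let $\mathcal L_4$ be the set of lines tangent to $\mathcal Q_0$, not through $U_4$, meeting $\pi$ in exactly one point, this point lying in $\mathcal E$. Let $\mathcal L_4'$ be the set of lines that are secant to every $\mathcal Q_\lambda$, $\lambda\in{\rm GF}(q)$, and meet $\pi$ in exactly one point, this point lying in $\mathcal C$. Then every line of $\mathcal L_4$ is secant to every hyperbolic quadric $\mathcal Q_\lambda$ and external to every elliptic quadric $\mathcal Q_\lambda$; and every line of $\mathcal L_4'$ is secant to every quadric $\mathcal Q_\lambda$, $\lambda\in{\rm GF}(q)$.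
   Context: A point of $\pi$ not on $\mathcal C$ is external to $\mathcal C$ if it lies on two tangent lines of $\mathcal C$. A line not contained in a quadric is tangent to it if it meets it in exactly one point, secant if in exactly two points, external if in none. -}

module Defs where

open import Level using (Level; _⊔_; Lift)
import Level
open import Algebra.Bundles using (CommutativeRing)
open import Data.Nat using (ℕ; _^_; _≥_)
open import Data.Nat.Primality using (Prime)
open import Data.Fin using (Fin; zero; suc)
open import Data.Product using (Σ; ∃; ∃-syntax; _×_; _,_)
open import Data.Sum using (_⊎_)
open import Relation.Nullary using (¬_)
open import Relation.Binary.PropositionalEquality using (_≡_)

record IsField {c ℓ : Level} (R : CommutativeRing c ℓ) : Set (c ⊔ ℓ) where
  open CommutativeRing R hiding (zero)
  field
    1≉0     : ¬ (1# ≈ 0#)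
    inverse : ∀ x → ¬ (x ≈ 0#) → ∃[ y ] (x * y ≈ 1#)

record HasCard {c ℓ : Level} (R : CommutativeRing c ℓ) (q : ℕ) : Set (c ⊔ ℓ) where
  open CommutativeRing R hiding (zero)
  field
    enum     : Fin q → Carrier
    enum-inj : ∀ i j → enum i ≈ enum j → i ≡ j
    enum-sur : ∀ x → ∃[ i ] (enum i ≈ x)

OddPrimePower : ℕ → Set
OddPrimePower q = ∃[ p ] ∃[ k ] (Prime p × ¬ (p ≡ 2) × k ≥ 1 × q ≡ p ^ k)

-- Projective geometry PG(3,F) over the field carried by R.
-- Coordinates X1..X4 are indices 0..3 of Fin 4.
module Geometry {c ℓ : Level} (R : CommutativeRing c ℓ) where
  open CommutativeRing R hiding (zero)

  V4 : Set c
  V4 = Fin 4 → Carrier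

  x1 x2 x3 x4 : V4 → Carrier
  x1 v = v zero
  x2 v = v (suc zero)
  x3 v = v (suc (suc zero))
  x4 v = v (suc (suc (suc zero)))

  NonZero : V4 → Set ℓ
  NonZero v = ¬ (∀ i → v i ≈ 0#)

  SamePoint : V4 → V4 → Set (c ⊔ ℓ)
  SamePoint u v = ∃[ a ] (¬ (a ≈ 0#) × (∀ i → u i ≈ a * v i))

  U3 U4 : V4
  U3 zero = 0#
  U3 (suc zero) = 0#
  U3 (suc (suc zero)) = 1#
  U3 (suc (suc (suc zero))) = 0#
  U4 zero = 0#
  U4 (suc zero) = 0#
  U4 (suc (suc zero)) = 0#
  U4 (suc (suc (suc zero))) = 1#

  conicPt : Carrier → V4
  conicPt t zero = 1#
  conicPt t (suc zero) = t
  conicPt t (suc (suc zero)) = t * t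
  conicPt t (suc (suc (suc zero))) = 0#

  record Line : Set (c ⊔ ℓ) where
    field
      a b   : V4
      indep : ∀ s t → (∀ i → s * a i + t * b i ≈ 0#) → (s ≈ 0#) × (t ≈ 0#)

  OnLine : Line → V4 → Set (c ⊔ ℓ)
  OnLine L v = ∃[ s ] ∃[ t ] (∀ i → v i ≈ s * Line.a L i + t * Line.b L i)

  -- point sets are given by predicates on vectors (of non-zero vectors)
  PointSet : Set (Level.suc (c ⊔ ℓ))
  PointSet = V4 → Set (c ⊔ ℓ)

  Contained : Line → PointSet → Set (c ⊔ ℓ)
  Contained L S = ∀ v → NonZero v → OnLine L v → S v

  MeetsOne : Line → PointSet → Set (c ⊔ ℓ)
  MeetsOne L S = ∃[ v ] (NonZero v × OnLine L v × S v ×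
                   (∀ w → NonZero w → OnLine L w → S w → SamePoint w v))

  MeetsTwo : Line → PointSet → Set (c ⊔ ℓ)
  MeetsTwo L S = ∃[ v ] ∃[ v' ] (NonZero v × OnLine L v × S v ×
                   NonZero v' × OnLine L v' × S v' × ¬ SamePoint v v' ×
                   (∀ w → NonZero w → OnLine L w → S w → SamePoint w v ⊎ SamePoint w v'))

  MeetsNone : Line → PointSet → Set (c ⊔ ℓ)
  MeetsNone L S = ∀ v → NonZero v → OnLine L v → ¬ S v

  Tangent Secant External : Line → PointSet → Set (c ⊔ ℓ)
  Tangent L S = ¬ Contained L S × MeetsOne L S
  Secant L S = ¬ Contained L S × MeetsTwo L S
  External L S = ¬ Contained L S × MeetsNone L S

  Q : Carrier → PointSet
  Q λ' v = Lift (c ⊔ ℓ) (x1 v * x3 v - x2 v * x2 v + λ' * (x4 v * x4 v) ≈ 0#)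

  π : PointSet
  π v = Lift (c ⊔ ℓ) (x4 v ≈ 0#)

  C : PointSet
  C v = (∃[ t ] SamePoint v (conicPt t)) ⊎ SamePoint v U3

  LineOfπ : Line → Set (c ⊔ ℓ)
  LineOfπ L = Contained L π

  TangentC : Line → Set (c ⊔ ℓ)
  TangentC L = LineOfπ L × Tangent L C

  E : PointSet
  E v = π v × ¬ C v × ∃[ L₁ ] ∃[ L₂ ] (TangentC L₁ × TangentC L₂ ×
          OnLine L₁ v × OnLine L₂ v ×
          ∃[ w ] (NonZero w × OnLine L₁ w × ¬ OnLine L₂ w))

  MeetsπOnlyIn : Line → PointSet → Set (c ⊔ ℓ)
  MeetsπOnlyIn L S = MeetsOne L π × (∀ v → NonZero v → OnLine L v → π v → S v)

  L4 : Line → Set (c ⊔ ℓ)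
  L4 L = Tangent L (Q 0#) × ¬ OnLine L U4 × MeetsπOnlyIn L E

  L4' : Line → Set (c ⊔ ℓ)
  L4' L = (∀ λ' → Secant L (Q λ')) × MeetsπOnlyIn L C

  IsSquare : Carrier → Set (c ⊔ ℓ)
  IsSquare x = ∃[ μ ] (x ≈ μ * μ)

  Hyperbolic Elliptic : Carrier → Set (c ⊔ ℓ)
  Hyperbolic λ' = ¬ (λ' ≈ 0#) × IsSquare λ'
  Elliptic λ' = ¬ IsSquare λ'

module Submission where

-- Let P be the point where a line L of L₄ meets the plane π, and T its point of
-- tangency with the cone Q₀.  Since P ∉ C, the form Q₀(v) = X₁X₃ - X₂² is
-- non-zero at P; tangency forces P to be conjugate (for the polar form of Q₀)
-- both to T and to the point of contact of a tangent of C through P, and the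
-- latter makes -Q₀(P) a non-zero square μ².  Because T ∉ π, every point of L is
-- ξ P + η T, and on it Q_λ takes the value  λ τ² η² - μ² ξ²  (τ = X₄(T)).  So L
-- meets Q_λ in no point when λ is a non-square, and in the two points
-- (κτ : ±μ) when λ = κ² ≠ 0 (distinct as the characteristic is odd).  The
-- statement about L₄' is part of the definition of L₄'.

open import Defs
open import Level using (Level)
open import Algebra.Bundles using (CommutativeRing)
open import Data.Nat using (ℕ)
open import Data.Product using (_×_)

open import Level using (lift; lower)
open import Data.Nat as ℕ using (zero; suc; _^_)
import Data.Nat.Properties as ℕ
open import Data.Nat.Divisibility using (_∣_; divides; ∣1⇒≡1)
open import Data.Nat.Primality using (euclidsLemma; prime[2]; prime⇒irreducible)
open import Data.Integer as ℤ using (ℤ; +_; -[1+_]; +[1+_]; _⊖_)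
open import Data.Integer.Properties as ℤ using ()
open import Data.Empty using (⊥; ⊥-elim)
open import Data.Fin using (Fin; _<_; _<?_) renaming (_≟_ to _≟ᶠ_)
import Data.Fin as Fin
open import Data.Fin.Properties using (<-cmp; <-asym; all?)
open import Data.List using (List; _++_; map; filter; length; allFin)
open import Data.List.Properties using (length-++; length-map; length-tabulate)
open import Data.List.Membership.Propositional using (_∈_)
open import Data.List.Membership.Propositional.Properties
  using (∈-allFin; ∈-filter⁺; ∈-filter⁻; ∈-map⁺; ∈-map⁻; ∈-++⁺ˡ; ∈-++⁺ʳ)
open import Data.List.Membership.Propositional.Properties.WithK using (unique∧set⇒bag)
open import Data.List.Relation.Unary.Unique.Propositional using (Unique)
open import Data.List.Relation.Unary.Unique.Propositional.Properties
  using (allFin⁺; filter⁺; map⁺; ++⁺)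
open import Data.List.Relation.Binary.BagAndSetEquality using (∼bag⇒↭)
open import Data.List.Relation.Binary.Permutation.Propositional using (_↭_)
open import Data.List.Relation.Binary.Permutation.Propositional.Properties using (↭-length)
import Data.Maybe as Maybe
open import Data.Product using (∃-syntax; _,_; proj₁; proj₂)
open import Data.Sum using (_⊎_; inj₁; inj₂) renaming (map to ⊎-map)
open import Function.Bundles using (mk⇔)
open import Relation.Nullary using (¬_; Dec; yes; no)
open import Relation.Nullary.Decidable using (dec⇒maybe)
open import Relation.Binary.Definitions using (Decidable; tri<; tri≈; tri>)
open import Relation.Binary.PropositionalEquality as ≡ using (_≡_; _≢_)
open import Algebra.Solver.Ring.AlmostCommutativeRing
  using (_-Raw-AlmostCommutative⟶_; fromCommutativeRing)

-- A fixed-point-free involution σ of Fin n pairs every i with σ i, so Fin n is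
-- the disjoint union of A = {i | i < σ i} and σ(A), and n = 2 · |A|.
involution⇒even : ∀ {n} (σ : Fin n → Fin n) → (∀ i → σ (σ i) ≡ i) → (∀ i → σ i ≢ i) → 2 ∣ n
involution⇒even {n} σ involutive fixedPointFree = divides (length A) n≡|A|*2
  where
  below? : ∀ i → Dec (i < σ i)
  below? i = i <? σ i

  A : List (Fin n)
  A = filter below? (allFin n)

  A-unique : Unique A
  A-unique = filter⁺ below? {allFin n} (allFin⁺ n)

  σ-injective : ∀ {i j} → σ i ≡ σ j → i ≡ j
  σ-injective {i} {j} e = ≡.trans (≡.sym (involutive i)) (≡.trans (≡.cong σ e) (involutive j))

  covers : ∀ i → i ∈ A ++ map σ A
  covers i with <-cmp i (σ i)
  ... | tri< i<σi _ _ = ∈-++⁺ˡ (∈-filter⁺ below? (∈-allFin i) i<σi)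
  ... | tri≈ _ i≡σi _ = ⊥-elim (fixedPointFree i (≡.sym i≡σi))
  ... | tri> _ _ σi<i = ∈-++⁺ʳ A (≡.subst (_∈ map σ A) (involutive i)
          (∈-map⁺ σ (∈-filter⁺ below? (∈-allFin (σ i)) (≡.subst (σ i <_) (≡.sym (involutive i)) σi<i))))

  -- σ moves the elements of A up and those of σ(A) down
  disjoint : ∀ {i} → i ∈ A → i ∈ map σ A → ⊥
  disjoint i∈A i∈σA with ∈-filter⁻ below? {xs = allFin n} i∈A | ∈-map⁻ σ i∈σA
  ... | _ , i<σi | j , j∈A , ≡.refl with ∈-filter⁻ below? {xs = allFin n} j∈A
  ...   | _ , j<σj = <-asym i<σi (≡.subst (_< σ j) (≡.sym (involutive j)) j<σj)

  allFin↭halves : allFin n ↭ A ++ map σ A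
  allFin↭halves = ∼bag⇒↭ (unique∧set⇒bag (allFin⁺ n)
      (++⁺ A-unique (map⁺ σ-injective A-unique) (λ (p , q) → disjoint p q))
      (mk⇔ (λ _ → covers _) (λ _ → ∈-allFin _)))

  n≡|A|*2 : n ≡ length A ℕ.* 2
  n≡|A|*2 = begin
    n                                ≡⟨ ≡.sym (length-tabulate (λ i → i)) ⟩
    length (allFin n)                ≡⟨ ↭-length allFin↭halves ⟩
    length (A ++ map σ A)            ≡⟨ length-++ A ⟩
    length A ℕ.+ length (map σ A)    ≡⟨ ≡.cong (length A ℕ.+_) (length-map σ A) ⟩
    length A ℕ.+ length A            ≡⟨ ≡.cong (length A ℕ.+_) (≡.sym (ℕ.+-identityʳ (length A))) ⟩
    2 ℕ.* length A                   ≡⟨ ℕ.*-comm 2 (length A) ⟩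
    length A ℕ.* 2                   ∎
    where open ≡.≡-Reasoning

oddPrimePower⇒odd : ∀ {q} → OddPrimePower q → ¬ 2 ∣ q
oddPrimePower⇒odd (p , k , p-prime , p≢2 , _ , ≡.refl) = 2∤p^ k
  where
  2∤p^ : ∀ k → ¬ 2 ∣ p ^ k
  2∤p^ zero 2∣1 with ∣1⇒≡1 2∣1
  ... | ()
  2∤p^ (suc k) 2∣p^[1+k] with euclidsLemma p (p ^ k) prime[2] 2∣p^[1+k]
  ... | inj₂ 2∣p^k = 2∤p^ k 2∣p^k
  ... | inj₁ 2∣p with prime⇒irreducible p-prime 2∣p
  ...   | inj₁ ()
  ...   | inj₂ 2≡p = p≢2 (≡.sym 2≡p)

-- With this homomorphism the
-- library's ring solver normalises polynomial identities of R with integer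
-- coefficients, so that for instance x - x cancels.
module IntegerCoefficients {c ℓ : Level} (R : CommutativeRing c ℓ) where
  open CommutativeRing R hiding (zero)
  open import Algebra.Properties.Semiring.Mult.TCOptimised semiring using (1+×; ×-homo-+; ×1-homo-*) renaming (_×_ to _×′_)
  open import Algebra.Properties.Ring ring using (-0#≈0#; -‿involutive; -‿+-comm; -‿distribˡ-*; -‿distribʳ-*)
  open import Relation.Binary.Reasoning.Setoid setoid

  ⟦_⟧ℤ : ℤ → Carrier
  ⟦ + n ⟧ℤ      = n ×′ 1#
  ⟦ -[1+ n ] ⟧ℤ = - (suc n ×′ 1#)

  ⟦⟧-cong : ∀ {i j} → i ≡ j → ⟦ i ⟧ℤ ≈ ⟦ j ⟧ℤ
  ⟦⟧-cong ≡.refl = refl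

  neg-homo : ∀ i → ⟦ ℤ.- i ⟧ℤ ≈ - ⟦ i ⟧ℤ
  neg-homo (+ zero) = sym -0#≈0#
  neg-homo +[1+ n ] = refl
  neg-homo -[1+ n ] = sym (-‿involutive _)

  ⊖-homo : ∀ m n → ⟦ m ⊖ n ⟧ℤ ≈ m ×′ 1# - n ×′ 1#
  ⊖-homo m       zero    = sym (trans (+-congˡ -0#≈0#) (+-identityʳ _))
  ⊖-homo zero    (suc n) = sym (+-identityˡ _)
  ⊖-homo (suc m) (suc n) = begin
    ⟦ suc m ⊖ suc n ⟧ℤ              ≈⟨ ⟦⟧-cong (ℤ.[1+m]⊖[1+n]≡m⊖n m n) ⟩
    ⟦ m ⊖ n ⟧ℤ                      ≈⟨ ⊖-homo m n ⟩
    m ×′ 1# - n ×′ 1#                 ≈⟨ shift (m ×′ 1#) (n ×′ 1#) ⟨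
    (1# + m ×′ 1#) - (1# + n ×′ 1#)   ≈⟨ +-cong (1+× m 1#) (-‿cong (1+× n 1#)) ⟨
    suc m ×′ 1# - suc n ×′ 1#         ∎
    where
    shift : ∀ a b → (1# + a) - (1# + b) ≈ a - b
    shift a b = begin
      (1# + a) + - (1# + b)     ≈⟨ +-congˡ (-‿+-comm 1# b) ⟨
      (1# + a) + (- 1# + - b)   ≈⟨ +-assoc 1# a _ ⟩
      1# + (a + (- 1# + - b))   ≈⟨ +-congˡ (+-comm a _) ⟩
      1# + ((- 1# + - b) + a)   ≈⟨ +-congˡ (+-assoc _ _ a) ⟩
      1# + (- 1# + (- b + a))   ≈⟨ +-assoc 1# _ _ ⟨
      (1# - 1#) + (- b + a)     ≈⟨ +-cong (-‿inverseʳ 1#) (+-comm _ a) ⟩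
      0# + (a - b)              ≈⟨ +-identityˡ _ ⟩
      a - b                     ∎

  +-homo : ∀ i j → ⟦ i ℤ.+ j ⟧ℤ ≈ ⟦ i ⟧ℤ + ⟦ j ⟧ℤ
  +-homo (+ m)    (+ n)    = ×-homo-+ 1# m n
  +-homo (+ m)    -[1+ n ] = ⊖-homo m (suc n)
  +-homo -[1+ m ] (+ n)    = trans (⊖-homo n (suc m)) (+-comm _ _)
  +-homo -[1+ m ] -[1+ n ] = begin
    - (suc (suc (m ℕ.+ n)) ×′ 1#)     ≈⟨ -‿cong (⟦⟧-cong (≡.cong +[1+_] (ℕ.+-suc m n))) ⟨
    - ((suc m ℕ.+ suc n) ×′ 1#)       ≈⟨ -‿cong (×-homo-+ 1# (suc m) (suc n)) ⟩
    - (suc m ×′ 1# + suc n ×′ 1#)      ≈⟨ -‿+-comm _ _ ⟨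
    - (suc m ×′ 1#) + - (suc n ×′ 1#)  ∎

  *-homo⁺ : ∀ m j → ⟦ + m ℤ.* j ⟧ℤ ≈ ⟦ + m ⟧ℤ * ⟦ j ⟧ℤ
  *-homo⁺ m (+ n)    = trans (⟦⟧-cong (≡.sym (ℤ.pos-* m n))) (×1-homo-* m n)
  *-homo⁺ m -[1+ n ] = begin
    ⟦ + m ℤ.* -[1+ n ] ⟧ℤ        ≈⟨ ⟦⟧-cong (ℤ.neg-distribʳ-* (+ m) +[1+ n ]) ⟨
    ⟦ ℤ.- (+ m ℤ.* +[1+ n ]) ⟧ℤ  ≈⟨ neg-homo (+ m ℤ.* +[1+ n ]) ⟩
    - ⟦ + m ℤ.* +[1+ n ] ⟧ℤ      ≈⟨ -‿cong (*-homo⁺ m +[1+ n ]) ⟩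
    - (m ×′ 1# * (suc n ×′ 1#))    ≈⟨ -‿distribʳ-* _ _ ⟩
    m ×′ 1# * - (suc n ×′ 1#)      ∎

  *-homo : ∀ i j → ⟦ i ℤ.* j ⟧ℤ ≈ ⟦ i ⟧ℤ * ⟦ j ⟧ℤ
  *-homo (+ m)    j = *-homo⁺ m j
  *-homo -[1+ m ] j = begin
    ⟦ -[1+ m ] ℤ.* j ⟧ℤ          ≈⟨ ⟦⟧-cong (ℤ.neg-distribˡ-* +[1+ m ] j) ⟨
    ⟦ ℤ.- (+[1+ m ] ℤ.* j) ⟧ℤ    ≈⟨ neg-homo (+[1+ m ] ℤ.* j) ⟩
    - ⟦ +[1+ m ] ℤ.* j ⟧ℤ        ≈⟨ -‿cong (*-homo⁺ (suc m) j) ⟩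
    - (suc m ×′ 1# * ⟦ j ⟧ℤ)      ≈⟨ -‿distribˡ-* _ _ ⟩
    - (suc m ×′ 1#) * ⟦ j ⟧ℤ      ∎

  ℤ⟶R : ℤ.+-*-rawRing -Raw-AlmostCommutative⟶ fromCommutativeRing R
  ℤ⟶R = record
    { ⟦_⟧ = ⟦_⟧ℤ ; +-homo = +-homo ; *-homo = *-homo ; -‿homo = neg-homo
    ; 0-homo = refl ; 1-homo = refl }

  open import Algebra.Solver.Ring ℤ.+-*-rawRing (fromCommutativeRing R) ℤ⟶R
    (λ i j → Maybe.map ⟦⟧-cong (dec⇒maybe (i ℤ.≟ j)))
    public using (solve; _:=_; _:+_; _:*_; _:-_; :-_; con; Polynomial)

-- A finite field has decidable equality, and has odd characteristic when its
-- order is odd: otherwise x ↦ x + 1 would be a fixed-point-free involution.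
module FiniteField {c ℓ : Level} (R : CommutativeRing c ℓ) (F : IsField R) {q : ℕ} (card : HasCard R q) where
  open CommutativeRing R hiding (zero)
  open HasCard card
  open import Algebra.Properties.Ring ring using (+-cancelˡ)

  _≟_ : Decidable _≈_
  x ≟ y with enum-sur x | enum-sur y
  ... | i , eᵢ≈x | j , eⱼ≈y with i ≟ᶠ j
  ...   | yes ≡.refl = yes (trans (sym eᵢ≈x) eⱼ≈y)
  ...   | no i≢j     = no (λ x≈y → i≢j (enum-inj i j (trans eᵢ≈x (trans x≈y (sym eⱼ≈y)))))

  1+1≉0 : OddPrimePower q → ¬ 1# + 1# ≈ 0#
  1+1≉0 odd 1+1≈0 = oddPrimePower⇒odd odd (involution⇒even σ involutive fixedPointFree)
    where
    σ : Fin q → Fin q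
    σ i = proj₁ (enum-sur (enum i + 1#))

    enum-σ : ∀ i → enum (σ i) ≈ enum i + 1#
    enum-σ i = proj₂ (enum-sur (enum i + 1#))

    involutive : ∀ i → σ (σ i) ≡ i
    involutive i = enum-inj _ _ (begin
      enum (σ (σ i))     ≈⟨ enum-σ (σ i) ⟩
      enum (σ i) + 1#    ≈⟨ +-congʳ (enum-σ i) ⟩
      enum i + 1# + 1#   ≈⟨ +-assoc _ _ _ ⟩
      enum i + (1# + 1#) ≈⟨ +-congˡ 1+1≈0 ⟩
      enum i + 0#        ≈⟨ +-identityʳ _ ⟩
      enum i             ∎)
      where open import Relation.Binary.Reasoning.Setoid setoid

    fixedPointFree : ∀ i → σ i ≢ i
    fixedPointFree i σi≡i = IsField.1≉0 F (+-cancelˡ (enum i) 1# 0#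
      (trans (sym (enum-σ i)) (trans (reflexive (≡.cong enum σi≡i)) (sym (+-identityʳ _)))))

module FieldFacts {c ℓ : Level} (R : CommutativeRing c ℓ) (F : IsField R)
                  (_≟_ : Decidable (CommutativeRing._≈_ R)) where
  open CommutativeRing R hiding (zero)
  open IsField F
  open import Algebra.Properties.Ring ring using (+-inverseˡ-unique; x≈y⇒x∙y⁻¹≈ε; x∙y⁻¹≈ε⇒x≈y)
  open import Relation.Binary.Reasoning.Setoid setoid
  open IntegerCoefficients R

  *-zeroʳ : ∀ a {b} → b ≈ 0# → a * b ≈ 0#
  *-zeroʳ a b≈0 = trans (*-congˡ b≈0) (zeroʳ a)

  *-nonzero : ∀ {a b} → ¬ a ≈ 0# → ¬ b ≈ 0# → ¬ a * b ≈ 0#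
  *-nonzero {a} {b} a≉0 b≉0 ab≈0 with inverse a a≉0
  ... | a⁻¹ , aa⁻¹≈1 = b≉0 (begin
    b              ≈⟨ *-identityˡ b ⟨
    1# * b         ≈⟨ *-congʳ (trans (sym aa⁻¹≈1) (*-comm a a⁻¹)) ⟩
    a⁻¹ * a * b    ≈⟨ *-assoc a⁻¹ a b ⟩
    a⁻¹ * (a * b)  ≈⟨ *-zeroʳ a⁻¹ ab≈0 ⟩
    0#             ∎)

  zero-product : ∀ {a b} → a * b ≈ 0# → a ≈ 0# ⊎ b ≈ 0#
  zero-product {a} {b} ab≈0 with a ≟ 0# | b ≟ 0#
  ... | yes a≈0 | _       = inj₁ a≈0
  ... | no _    | yes b≈0 = inj₂ b≈0
  ... | no a≉0  | no b≉0  = ⊥-elim (*-nonzero a≉0 b≉0 ab≈0)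

  cancel : ∀ {a b} → ¬ a ≈ 0# → a * b ≈ 0# → b ≈ 0#
  cancel a≉0 ab≈0 with zero-product ab≈0
  ... | inj₁ a≈0 = ⊥-elim (a≉0 a≈0)
  ... | inj₂ b≈0 = b≈0

  square-zero : ∀ {a} → a * a ≈ 0# → a ≈ 0#
  square-zero aa≈0 with zero-product aa≈0
  ... | inj₁ a≈0 = a≈0
  ... | inj₂ a≈0 = a≈0

  difference-of-squares : ∀ a b → (a - b) * (a + b) ≈ a * a - b * b
  difference-of-squares = solve 2 (λ a b → (a :- b) :* (a :+ b) := a :* a :- b :* b) refl

  equal-squares : ∀ {a b} → a * a ≈ b * b → a ≈ b ⊎ a ≈ - b
  equal-squares {a} {b} aa≈bb with zero-product (trans (difference-of-squares a b) (x≈y⇒x∙y⁻¹≈ε aa≈bb))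
  ... | inj₁ a-b≈0 = inj₁ (x∙y⁻¹≈ε⇒x≈y a b a-b≈0)
  ... | inj₂ a+b≈0 = inj₂ (+-inverseˡ-unique a b a+b≈0)

  square-quotient : ∀ {λ' a b} → λ' * (a * a) ≈ b * b → ¬ a ≈ 0# → ∃[ μ ] (λ' ≈ μ * μ)
  square-quotient {λ'} {a} {b} λaa≈bb a≉0 with inverse a a≉0
  ... | a⁻¹ , aa⁻¹≈1 = b * a⁻¹ , (begin
    λ'                                ≈⟨ *-identityʳ λ' ⟨
    λ' * 1#                           ≈⟨ *-congˡ (trans (*-cong aa⁻¹≈1 aa⁻¹≈1) (*-identityʳ 1#)) ⟨
    λ' * ((a * a⁻¹) * (a * a⁻¹))      ≈⟨ solve 3 (λ λ' a a⁻¹ → λ' :* ((a :* a⁻¹) :* (a :* a⁻¹))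
                                            := λ' :* (a :* a) :* (a⁻¹ :* a⁻¹)) refl λ' a a⁻¹ ⟩
    λ' * (a * a) * (a⁻¹ * a⁻¹)        ≈⟨ *-congʳ λaa≈bb ⟩
    b * b * (a⁻¹ * a⁻¹)               ≈⟨ solve 2 (λ b a⁻¹ → b :* b :* (a⁻¹ :* a⁻¹) := (b :* a⁻¹) :* (b :* a⁻¹))
                                            refl b a⁻¹ ⟩
    (b * a⁻¹) * (b * a⁻¹)             ∎)

module Quadrics {c ℓ : Level} (R : CommutativeRing c ℓ) (F : IsField R)
                (_≟_ : Decidable (CommutativeRing._≈_ R)) where
  open CommutativeRing R hiding (zero)
  open IsField F
  open Geometry R
  open FieldFacts R F _≟_
  open IntegerCoefficients R
  open import Algebra.Properties.Ring ring using (x≈y⇒x∙y⁻¹≈ε; x∙y⁻¹≈ε⇒x≈y; -‿involutive; -0#≈0#; +-inverseˡ-unique; -‿distribˡ-*)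
  open import Relation.Binary.Reasoning.Setoid setoid

  form : Carrier → V4 → Carrier
  form λ' v = x1 v * x3 v - x2 v * x2 v + λ' * (x4 v * x4 v)

  two : Carrier
  two = 1# + 1#

  -- the polar bilinear form of Q_λ; u and v are conjugate when it vanishes
  polar : Carrier → V4 → V4 → Carrier
  polar λ' u v = x1 u * x3 v + x3 u * x1 v - two * (x2 u * x2 v) + two * λ' * (x4 u * x4 v)

  :form : ∀ {n} → (λ' a b c d : Polynomial n) → Polynomial n
  :form λ' a b c d = a :* c :- b :* b :+ λ' :* (d :* d)

  :polar : ∀ {n} → (λ' a b c d a' b' c' d' : Polynomial n) → Polynomial n
  :polar λ' a b c d a' b' c' d' =
    a :* c' :+ c :* a' :- con (+ 2) :* (b :* b') :+ con (+ 2) :* λ' :* (d :* d')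

  _≋_ : V4 → V4 → Set ℓ
  u ≋ v = ∀ i → u i ≈ v i

  scale : Carrier → V4 → V4
  scale k v i = k * v i

  comb : Carrier → V4 → Carrier → V4 → V4
  comb x u y v i = x * u i + y * v i

  form-cong : ∀ λ' {u v} → u ≋ v → form λ' u ≈ form λ' v
  form-cong λ' u≋v = +-cong (+-cong (*-cong (u≋v _) (u≋v _)) (-‿cong (*-cong (u≋v _) (u≋v _))))
                            (*-congˡ (*-cong (u≋v _) (u≋v _)))

  polar-cong : ∀ λ' u {v w} → v ≋ w → polar λ' u v ≈ polar λ' u w
  polar-cong λ' u v≋w = +-cong (+-cong (+-cong (*-congˡ (v≋w _)) (*-congˡ (v≋w _)))
                                       (-‿cong (*-congˡ (*-congˡ (v≋w _)))))
                               (*-congˡ (*-congˡ (v≋w _)))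

  form-comb : ∀ λ' x u y v →
              form λ' (comb x u y v) ≈ x * x * form λ' u + x * y * polar λ' u v + y * y * form λ' v
  form-comb λ' x u y v = solve 11 (λ λ' x y a b c d a' b' c' d' →
      :form λ' (x :* a :+ y :* a') (x :* b :+ y :* b') (x :* c :+ y :* c') (x :* d :+ y :* d')
      := x :* x :* :form λ' a b c d :+ x :* y :* :polar λ' a b c d a' b' c' d' :+ y :* y :* :form λ' a' b' c' d')
    refl λ' x y (x1 u) (x2 u) (x3 u) (x4 u) (x1 v) (x2 v) (x3 v) (x4 v)

  form-scale : ∀ λ' k v → form λ' (scale k v) ≈ k * k * form λ' v
  form-scale λ' k v = solve 6 (λ λ' k a b c d →
      :form λ' (k :* a) (k :* b) (k :* c) (k :* d) := k :* k :* :form λ' a b c d)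
    refl λ' k (x1 v) (x2 v) (x3 v) (x4 v)

  polar-scale : ∀ λ' u k v → polar λ' u (scale k v) ≈ k * polar λ' u v
  polar-scale λ' u k v = solve 10 (λ λ' k a b c d a' b' c' d' →
      :polar λ' a b c d (k :* a') (k :* b') (k :* c') (k :* d') := k :* :polar λ' a b c d a' b' c' d')
    refl λ' k (x1 u) (x2 u) (x3 u) (x4 u) (x1 v) (x2 v) (x3 v) (x4 v)

  form-split : ∀ λ' v → form λ' v ≈ form 0# v + λ' * (x4 v * x4 v)
  form-split λ' v = solve 5 (λ λ' a b c d →
      :form λ' a b c d := :form (con (+ 0)) a b c d :+ λ' :* (d :* d))
    refl λ' (x1 v) (x2 v) (x3 v) (x4 v)

  polar-split : ∀ λ' u v → polar λ' u v ≈ polar 0# u v + two * λ' * (x4 u * x4 v)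
  polar-split λ' u v = solve 9 (λ λ' a b c d a' b' c' d' →
      :polar λ' a b c d a' b' c' d' := :polar (con (+ 0)) a b c d a' b' c' d' :+ con (+ 2) :* λ' :* (d :* d'))
    refl λ' (x1 u) (x2 u) (x3 u) (x4 u) (x1 v) (x2 v) (x3 v) (x4 v)

  multiple-of : ∀ {w v} → (NonZero w → SamePoint w v) → ∃[ k ] (w ≋ scale k v)
  multiple-of {w} same with all? (λ i → w i ≟ 0#)
  ... | yes w≋0 = 0# , λ i → trans (w≋0 i) (sym (zeroˡ _))
  ... | no w≢0  = let (k , _ , w≋kv) = same w≢0 in k , w≋kv

  scaled⇒samePoint : ∀ {a b w v} → ¬ a ≈ 0# → ¬ b ≈ 0# → (∀ i → a * w i ≈ b * v i) → SamePoint w v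
  scaled⇒samePoint {a} {b} {w} {v} a≉0 b≉0 aw≈bv with inverse a a≉0
  ... | a⁻¹ , aa⁻¹≈1 = a⁻¹ * b , *-nonzero a⁻¹≉0 b≉0 , λ i → begin
      w i              ≈⟨ *-identityˡ (w i) ⟨
      1# * w i         ≈⟨ *-congʳ (trans (sym aa⁻¹≈1) (*-comm a a⁻¹)) ⟩
      a⁻¹ * a * w i    ≈⟨ *-assoc a⁻¹ a (w i) ⟩
      a⁻¹ * (a * w i)  ≈⟨ *-congˡ (aw≈bv i) ⟩
      a⁻¹ * (b * v i)  ≈⟨ *-assoc a⁻¹ b (v i) ⟨
      a⁻¹ * b * v i    ∎
    where
    a⁻¹≉0 : ¬ a⁻¹ ≈ 0#
    a⁻¹≉0 a⁻¹≈0 = 1≉0 (trans (sym aa⁻¹≈1) (*-zeroʳ a a⁻¹≈0))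

  samePoint-trans : ∀ {u v w} → SamePoint u v → SamePoint v w → SamePoint u w
  samePoint-trans {u} {v} {w} (a , a≉0 , u≋av) (b , b≉0 , v≋bw) = a * b , *-nonzero a≉0 b≉0 , λ i → begin
    u i            ≈⟨ u≋av i ⟩
    a * v i        ≈⟨ *-congˡ (v≋bw i) ⟩
    a * (b * w i)  ≈⟨ *-assoc a b (w i) ⟨
    a * b * w i    ∎

  samePoint-form : ∀ λ' {w v} → SamePoint w v → form λ' w ≈ 0# → form λ' v ≈ 0#
  samePoint-form λ' {w} {v} (a , a≉0 , w≋av) w∈Q = cancel (*-nonzero a≉0 a≉0) (begin
    a * a * form λ' v    ≈⟨ form-scale λ' a v ⟨
    form λ' (scale a v)  ≈⟨ form-cong λ' w≋av ⟨
    form λ' w            ≈⟨ w∈Q ⟩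
    0#                   ∎)

  polar-samePoint : ∀ λ' u {w v} → SamePoint w v → polar λ' u w ≈ 0# → polar λ' u v ≈ 0#
  polar-samePoint λ' u {w} {v} (a , a≉0 , w≋av) u⊥w = cancel a≉0 (begin
    a * polar λ' u v        ≈⟨ polar-scale λ' u a v ⟨
    polar λ' u (scale a v)  ≈⟨ polar-cong λ' u w≋av ⟨
    polar λ' u w            ≈⟨ u⊥w ⟩
    0#                      ∎)

  nonzero-annihilated : ∀ {a v} → NonZero v → (∀ i → a * v i ≈ 0#) → a ≈ 0#
  nonzero-annihilated {a} v≢0 av≈0 with a ≟ 0#
  ... | yes a≈0 = a≈0
  ... | no a≉0  = ⊥-elim (v≢0 (λ i → cancel a≉0 (av≈0 i)))

  onLine-comb : ∀ {L u v} x y → OnLine L u → OnLine L v → OnLine L (comb x u y v)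
  onLine-comb {L} {u} {v} x y (s , t , u≋) (s' , t' , v≋) = x * s + y * s' , x * t + y * t' , λ i → begin
    x * u i + y * v i
      ≈⟨ +-cong (*-congˡ (u≋ i)) (*-congˡ (v≋ i)) ⟩
    x * (s * a i + t * b i) + y * (s' * a i + t' * b i)
      ≈⟨ solve 8 (λ x y s t s' t' a b → x :* (s :* a :+ t :* b) :+ y :* (s' :* a :+ t' :* b)
                   := (x :* s :+ y :* s') :* a :+ (x :* t :+ y :* t') :* b) refl x y s t s' t' (a i) (b i) ⟩
    (x * s + y * s') * a i + (x * t + y * t') * b i ∎
    where open Line L using (a; b)

  -- If T is the only point of the line L on Q_λ, every point u of L off Q_λ is
  -- conjugate to T: otherwise H u - φ T (H = polar u T, φ = form u) would be a
  -- point of L on Q_λ other than T.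
  tangent⇒conjugate : ∀ {L λ' T u} →
    (∀ w → NonZero w → OnLine L w → form λ' w ≈ 0# → SamePoint w T) →
    OnLine L T → form λ' T ≈ 0# → OnLine L u → ¬ form λ' u ≈ 0# → polar λ' u T ≈ 0#
  tangent⇒conjugate {L} {λ'} {T} {u} only-T T-on T∈Q u-on u∉Q with polar λ' u T ≟ 0#
  ... | yes H≈0 = H≈0
  ... | no H≉0  = ⊥-elim (*-nonzero (*-nonzero H≉0 H≉0) u∉Q HHφ≈0)
    where
    H φ : Carrier
    H = polar λ' u T
    φ = form λ' u

    w : V4
    w = comb H u (- φ) T

    w∈Q : form λ' w ≈ 0#
    w∈Q = begin
      form λ' w                                          ≈⟨ form-comb λ' H u (- φ) T ⟩
      H * H * φ + H * - φ * H + - φ * - φ * form λ' T    ≈⟨ solve 3 (λ H φ q →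
          H :* H :* φ :+ H :* (:- φ) :* H :+ (:- φ) :* (:- φ) :* q := φ :* φ :* q) refl H φ (form λ' T) ⟩
      φ * φ * form λ' T                                  ≈⟨ *-zeroʳ (φ * φ) T∈Q ⟩
      0#                                                 ∎

    w-multiple : ∃[ k ] (w ≋ scale k T)
    w-multiple = multiple-of (λ w≢0 → only-T w w≢0 (onLine-comb {L} H (- φ) u-on T-on) w∈Q)

    k : Carrier
    k = proj₁ w-multiple

    Hu≋[k+φ]T : scale H u ≋ scale (k + φ) T
    Hu≋[k+φ]T i = begin
      H * u i              ≈⟨ solve 4 (λ H φ a b → H :* a := (H :* a :+ (:- φ) :* b) :+ φ :* b) refl H φ (u i) (T i) ⟩
      w i + φ * T i        ≈⟨ +-congʳ (proj₂ w-multiple i) ⟩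
      k * T i + φ * T i    ≈⟨ distribʳ (T i) k φ ⟨
      (k + φ) * T i        ∎

    HHφ≈0 : H * H * φ ≈ 0#
    HHφ≈0 = begin
      H * H * φ                      ≈⟨ form-scale λ' H u ⟨
      form λ' (scale H u)            ≈⟨ form-cong λ' Hu≋[k+φ]T ⟩
      form λ' (scale (k + φ) T)      ≈⟨ form-scale λ' (k + φ) T ⟩
      (k + φ) * (k + φ) * form λ' T  ≈⟨ *-zeroʳ _ T∈Q ⟩
      0#                             ∎

  C⊆Q₀ : ∀ {v} → C v → form 0# v ≈ 0#
  C⊆Q₀ {v} (inj₁ (t , k , _ , v≋k·c)) = begin
    form 0# v                        ≈⟨ form-cong 0# v≋k·c ⟩
    form 0# (scale k (conicPt t))    ≈⟨ form-scale 0# k (conicPt t) ⟩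
    k * k * form 0# (conicPt t)      ≈⟨ *-zeroʳ (k * k) (solve 1 (λ t →
        :form (con (+ 0)) (con (+ 1)) t (t :* t) (con (+ 0)) := con (+ 0)) refl t) ⟩
    0#                               ∎
  C⊆Q₀ {v} (inj₂ (k , _ , v≋k·U₃)) = begin
    form 0# v                        ≈⟨ form-cong 0# v≋k·U₃ ⟩
    form 0# (scale k U3)             ≈⟨ form-scale 0# k U3 ⟩
    k * k * form 0# U3               ≈⟨ *-zeroʳ (k * k) (solve 0
        (:form (con (+ 0)) (con (+ 0)) (con (+ 0)) (con (+ 1)) (con (+ 0)) := con (+ 0)) refl) ⟩
    0#                               ∎

  cone-x1≈0⇒x2≈0 : ∀ {w} → form 0# w ≈ 0# → x1 w ≈ 0# → x2 w ≈ 0#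
  cone-x1≈0⇒x2≈0 {w} w∈Q₀ w₁≈0 = square-zero (begin
    x2 w * x2 w                  ≈⟨ solve 4 (λ a b c d → b :* b := a :* c :- :form (con (+ 0)) a b c d)
                                      refl (x1 w) (x2 w) (x3 w) (x4 w) ⟩
    x1 w * x3 w - form 0# w      ≈⟨ +-cong (trans (*-congʳ w₁≈0) (zeroˡ _)) (-‿cong w∈Q₀) ⟩
    0# - 0#                      ≈⟨ -‿inverseʳ 0# ⟩
    0#                           ∎)

  π∩Q₀⊆C : ∀ {w} → NonZero w → x4 w ≈ 0# → form 0# w ≈ 0# → C w
  π∩Q₀⊆C {w} w≢0 w₄≈0 w∈Q₀ with x1 w ≟ 0#
  ... | no w₁≉0 = inj₁ (x2 w * j , x1 w , w₁≉0 , on-conic)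
    where
    j : Carrier
    j = proj₁ (inverse (x1 w) w₁≉0)
    w₁j-1≈0 : x1 w * j - 1# ≈ 0#
    w₁j-1≈0 = x≈y⇒x∙y⁻¹≈ε (proj₂ (inverse (x1 w) w₁≉0))
    -- w = w₁ · (1, t, t², 0) with t = w₂ / w₁
    on-conic : ∀ i → w i ≈ x1 w * conicPt (x2 w * j) i
    on-conic Fin.zero = sym (*-identityʳ _)
    on-conic (Fin.suc Fin.zero) = x∙y⁻¹≈ε⇒x≈y _ _ (begin
      x2 w - x1 w * (x2 w * j)       ≈⟨ solve 3 (λ a b j → b :- a :* (b :* j) := (:- b) :* (a :* j :- con (+ 1)))
                                          refl (x1 w) (x2 w) j ⟩
      - x2 w * (x1 w * j - 1#)       ≈⟨ *-zeroʳ _ w₁j-1≈0 ⟩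
      0#                             ∎)
    on-conic (Fin.suc (Fin.suc Fin.zero)) = x∙y⁻¹≈ε⇒x≈y _ _ (begin
      x3 w - x1 w * ((x2 w * j) * (x2 w * j))
        ≈⟨ solve 5 (λ a b c d j → c :- a :* ((b :* j) :* (b :* j))
              := (:- c) :* ((a :* j :- con (+ 1)) :* (a :* j :+ con (+ 1))) :+ (j :* j :* a) :* :form (con (+ 0)) a b c d)
            refl (x1 w) (x2 w) (x3 w) (x4 w) j ⟩
      - x3 w * ((x1 w * j - 1#) * (x1 w * j + 1#)) + j * j * x1 w * form 0# w
        ≈⟨ +-cong (*-zeroʳ _ (trans (*-congʳ w₁j-1≈0) (zeroˡ _))) (*-zeroʳ _ w∈Q₀) ⟩
      0# + 0#
        ≈⟨ +-identityʳ 0# ⟩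
      0# ∎)
    on-conic (Fin.suc (Fin.suc (Fin.suc Fin.zero))) = trans w₄≈0 (sym (zeroʳ _))
  ... | yes w₁≈0 with x3 w ≟ 0#
  ...   | yes w₃≈0 = ⊥-elim (w≢0 λ where
            Fin.zero → w₁≈0
            (Fin.suc Fin.zero) → cone-x1≈0⇒x2≈0 {w} w∈Q₀ w₁≈0
            (Fin.suc (Fin.suc Fin.zero)) → w₃≈0
            (Fin.suc (Fin.suc (Fin.suc Fin.zero))) → w₄≈0)
  ...   | no w₃≉0  = inj₂ (x3 w , w₃≉0 , λ where
            Fin.zero → trans w₁≈0 (sym (zeroʳ _))
            (Fin.suc Fin.zero) → trans (cone-x1≈0⇒x2≈0 {w} w∈Q₀ w₁≈0) (sym (zeroʳ _))
            (Fin.suc (Fin.suc Fin.zero)) → sym (*-identityʳ _)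
            (Fin.suc (Fin.suc (Fin.suc Fin.zero))) → trans w₄≈0 (sym (zeroʳ _)))

  -- if P is conjugate (for Q₀) to a point of C, then -Q₀(P) is a square:
  -- Q₀(P) + (P₂ - t P₁)² = P₁ · polar₀(P, (1, t, t², 0)) and Q₀(P) + P₂² = P₃ · polar₀(P, U₃)
  conjugate-to-C : ∀ {P T} → C T → polar 0# P T ≈ 0# → ∃[ μ ] (form 0# P + μ * μ ≈ 0#)
  conjugate-to-C {P} (inj₁ (t , T~c)) P⊥T = x2 P - t * x1 P , (begin
    form 0# P + (x2 P - t * x1 P) * (x2 P - t * x1 P)
      ≈⟨ solve 5 (λ a b c d t → :form (con (+ 0)) a b c d :+ (b :- t :* a) :* (b :- t :* a)
                    := a :* :polar (con (+ 0)) a b c d (con (+ 1)) t (t :* t) (con (+ 0)))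
          refl (x1 P) (x2 P) (x3 P) (x4 P) t ⟩
    x1 P * polar 0# P (conicPt t)
      ≈⟨ *-zeroʳ _ (polar-samePoint 0# P T~c P⊥T) ⟩
    0# ∎)
  conjugate-to-C {P} (inj₂ T~U₃) P⊥T = x2 P , (begin
    form 0# P + x2 P * x2 P
      ≈⟨ solve 4 (λ a b c d → :form (con (+ 0)) a b c d :+ b :* b
                    := c :* :polar (con (+ 0)) a b c d (con (+ 0)) (con (+ 0)) (con (+ 1)) (con (+ 0)))
          refl (x1 P) (x2 P) (x3 P) (x4 P) ⟩
    x3 P * polar 0# P U3
      ≈⟨ *-zeroʳ _ (polar-samePoint 0# P T~U₃ P⊥T) ⟩
    0# ∎)

  -- A line L meeting π only in the point P, through a point T ∉ π of the cone,
  -- where P is conjugate to T and Q₀(P) = -μ² ≠ 0.  Writing pt x y = x P + y T,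
  -- the points of L are the pt ξ η and Q_λ restricts to  λ τ² η² - μ² ξ².
  module Transversal (L : Line) (P T : V4) (μ : Carrier)
    (only-P-in-π : ∀ w → NonZero w → OnLine L w → π w → SamePoint w P)
    (P-on : OnLine L P) (P∈π : x4 P ≈ 0#) (T-on : OnLine L T) (T∉π : ¬ x4 T ≈ 0#)
    (Q₀[P]+μ² : form 0# P + μ * μ ≈ 0#) (μ≉0 : ¬ μ ≈ 0#)
    (P⊥T : polar 0# P T ≈ 0#) (T∈Q₀ : form 0# T ≈ 0#) where

    τ : Carrier
    τ = x4 T

    pt : Carrier → Carrier → V4
    pt x y = comb x P y T

    pt-on : ∀ x y → OnLine L (pt x y)
    pt-on x y = onLine-comb {L} x y P-on T-on

    pt₄ : ∀ x y → x4 (pt x y) ≈ y * τ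
    pt₄ x y = trans (+-congʳ (*-zeroʳ x P∈π)) (+-identityˡ _)

    pt-nonzero : ∀ {x y} → ¬ y ≈ 0# → NonZero (pt x y)
    pt-nonzero {x} {y} y≉0 pt≋0 = *-nonzero y≉0 T∉π (trans (sym (pt₄ x y)) (pt≋0 _))

    -- every point w of L is, up to the factor τ, the point pt ξ (X₄ w):
    -- τ w - X₄(w) T lies on L and in π, so it is a multiple of P
    coordinates : ∀ {w} → OnLine L w → ∃[ ξ ] (scale τ w ≋ pt ξ (x4 w))
    coordinates {w} w-on = ξ , λ i → begin
      τ * w i                                ≈⟨ solve 4 (λ τ a w₄ t → τ :* a := (τ :* a :+ (:- w₄) :* t) :+ w₄ :* t)
                                                  refl τ (w i) (x4 w) (T i) ⟩
      (τ * w i + - x4 w * T i) + x4 w * T i  ≈⟨ +-congʳ (proj₂ u-multiple i) ⟩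
      ξ * P i + x4 w * T i                   ∎
      where
      u : V4
      u = comb τ w (- x4 w) T
      u∈π : x4 u ≈ 0#
      u∈π = solve 2 (λ τ w₄ → τ :* w₄ :+ (:- w₄) :* τ := con (+ 0)) refl τ (x4 w)
      u-multiple : ∃[ ξ ] (u ≋ scale ξ P)
      u-multiple = multiple-of (λ u≢0 → only-P-in-π u u≢0 (onLine-comb {L} τ (- x4 w) w-on T-on) (lift u∈π))
      ξ : Carrier
      ξ = proj₁ u-multiple

    Q[P] : ∀ λ' → form λ' P ≈ - (μ * μ)
    Q[P] λ' = begin
      form λ' P                          ≈⟨ form-split λ' P ⟩
      form 0# P + λ' * (x4 P * x4 P)     ≈⟨ +-congˡ (*-zeroʳ λ' (*-zeroʳ (x4 P) P∈π)) ⟩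
      form 0# P + 0#                     ≈⟨ +-identityʳ _ ⟩
      form 0# P                          ≈⟨ +-inverseˡ-unique _ _ Q₀[P]+μ² ⟩
      - (μ * μ)                          ∎

    polar[P,T] : ∀ λ' → polar λ' P T ≈ 0#
    polar[P,T] λ' = begin
      polar λ' P T                              ≈⟨ polar-split λ' P T ⟩
      polar 0# P T + two * λ' * (x4 P * τ)      ≈⟨ +-cong P⊥T (*-zeroʳ _ (trans (*-congʳ P∈π) (zeroˡ τ))) ⟩
      0# + 0#                                   ≈⟨ +-identityʳ 0# ⟩
      0#                                        ∎

    Q[T] : ∀ λ' → form λ' T ≈ λ' * (τ * τ)
    Q[T] λ' = trans (form-split λ' T) (trans (+-congʳ T∈Q₀) (+-identityˡ _))

    pt-form : ∀ λ' x y → form λ' (pt x y) ≈ λ' * ((τ * y) * (τ * y)) - (μ * x) * (μ * x)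
    pt-form λ' x y = begin
      form λ' (pt x y)
        ≈⟨ form-comb λ' x P y T ⟩
      x * x * form λ' P + x * y * polar λ' P T + y * y * form λ' T
        ≈⟨ +-cong (+-cong (*-congˡ (Q[P] λ')) (*-congˡ (polar[P,T] λ'))) (*-congˡ (Q[T] λ')) ⟩
      x * x * - (μ * μ) + x * y * 0# + y * y * (λ' * (τ * τ))
        ≈⟨ solve 5 (λ λ' x y μ τ → x :* x :* (:- (μ :* μ)) :+ x :* y :* con (+ 0) :+ y :* y :* (λ' :* (τ :* τ))
                      := λ' :* ((τ :* y) :* (τ :* y)) :- (μ :* x) :* (μ :* x)) refl λ' x y μ τ ⟩
      λ' * ((τ * y) * (τ * y)) - (μ * x) * (μ * x) ∎

    -- L is not contained in any Q_λ, since P is on none of them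
    P∉Q : ∀ λ' → ¬ form λ' P ≈ 0#
    P∉Q λ' P∈Q = μ≉0 (square-zero (begin
      μ * μ           ≈⟨ -‿involutive _ ⟨
      - - (μ * μ)     ≈⟨ -‿cong (Q[P] λ') ⟨
      - form λ' P     ≈⟨ -‿cong P∈Q ⟩
      - 0#            ≈⟨ -0#≈0# ⟩
      0#              ∎))

    P≢0 : NonZero P
    P≢0 P≋0 = P∉Q 0# (begin
      form 0# P                ≈⟨ form-cong 0# (λ i → trans (P≋0 i) (sym (zeroˡ (P i)))) ⟩
      form 0# (scale 0# P)     ≈⟨ form-scale 0# 0# P ⟩
      0# * 0# * form 0# P      ≈⟨ trans (*-congʳ (zeroˡ 0#)) (zeroˡ _) ⟩
      0#                       ∎)

    not-contained : ∀ λ' → ¬ Contained L (Q λ')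
    not-contained λ' L⊆Q = P∉Q λ' (lower (L⊆Q P P≢0 P-on))

    on-Q-equation : ∀ λ' {w ξ} → scale τ w ≋ pt ξ (x4 w) → form λ' w ≈ 0# →
                    λ' * ((τ * x4 w) * (τ * x4 w)) ≈ (μ * ξ) * (μ * ξ)
    on-Q-equation λ' {w} {ξ} τw≋pt w∈Q = x∙y⁻¹≈ε⇒x≈y _ _ (begin
      λ' * ((τ * x4 w) * (τ * x4 w)) - (μ * ξ) * (μ * ξ)  ≈⟨ pt-form λ' ξ (x4 w) ⟨
      form λ' (pt ξ (x4 w))                               ≈⟨ form-cong λ' {scale τ w} {pt ξ (x4 w)} τw≋pt ⟨
      form λ' (scale τ w)                                 ≈⟨ form-scale λ' τ w ⟩
      τ * τ * form λ' w                                   ≈⟨ *-zeroʳ _ w∈Q ⟩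
      0#                                                  ∎)

    on-Q : ∀ λ' {w} → NonZero w → OnLine L w → form λ' w ≈ 0# →
           ∃[ ξ ] (SamePoint w (pt ξ (x4 w)) ×
                   λ' * ((τ * x4 w) * (τ * x4 w)) ≈ (μ * ξ) * (μ * ξ) × ¬ x4 w ≈ 0#)
    on-Q λ' {w} w≢0 w-on w∈Q = let (ξ , τw≋pt) = coordinates w-on in
      ξ , scaled⇒samePoint {τ} {1#} {w} {pt ξ (x4 w)} T∉π 1≉0 (λ i → trans (τw≋pt i) (sym (*-identityˡ _))) ,
      on-Q-equation λ' τw≋pt w∈Q , w∉π
      where
      -- a point of L in π is P, which is not on Q_λ
      w∉π : ¬ x4 w ≈ 0#
      w∉π w₄≈0 = P∉Q λ' (samePoint-form λ' {w} {P} (only-P-in-π w w≢0 w-on (lift w₄≈0)) w∈Q)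
    pt-samePoint : ∀ {x y x' y'} → x * y' ≈ x' * y → ¬ y ≈ 0# → ¬ y' ≈ 0# → SamePoint (pt x y) (pt x' y')
    pt-samePoint {x} {y} {x'} {y'} xy'≈x'y y≉0 y'≉0 = scaled⇒samePoint y'≉0 y≉0 λ i → begin
      y' * (x * P i + y * T i)     ≈⟨ solve 5 (λ x y y' p t → y' :* (x :* p :+ y :* t) := (x :* y') :* p :+ (y :* y') :* t)
                                        refl x y y' (P i) (T i) ⟩
      (x * y') * P i + (y * y') * T i   ≈⟨ +-congʳ (*-congʳ xy'≈x'y) ⟩
      (x' * y) * P i + (y * y') * T i   ≈⟨ solve 5 (λ x' y y' p t → y :* (x' :* p :+ y' :* t) := (x' :* y) :* p :+ (y :* y') :* t)
                                        refl x' y y' (P i) (T i) ⟨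
      y * (x' * P i + y' * T i)    ∎

    samePoint⇒proportional : ∀ {x y x' y'} → SamePoint (pt x y) (pt x' y') → x * y' ≈ x' * y
    samePoint⇒proportional {x} {y} {x'} {y'} (k , _ , pt≋kpt') = begin
      x * y'         ≈⟨ *-congʳ x≈kx' ⟩
      k * x' * y'    ≈⟨ solve 3 (λ k x' y' → k :* x' :* y' := x' :* (k :* y')) refl k x' y' ⟩
      x' * (k * y')  ≈⟨ *-congˡ y≈ky' ⟨
      x' * y         ∎
      where
      -- compare fourth coordinates
      y≈ky' : y ≈ k * y'
      y≈ky' = x∙y⁻¹≈ε⇒x≈y _ _ (cancel T∉π (begin
        τ * (y - k * y')       ≈⟨ solve 4 (λ τ y k y' → τ :* (y :- k :* y') := y :* τ :- k :* (y' :* τ)) refl τ y k y' ⟩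
        y * τ - k * (y' * τ)   ≈⟨ x≈y⇒x∙y⁻¹≈ε (trans (sym (pt₄ x y)) (trans (pt≋kpt' _) (*-congˡ (pt₄ x' y')))) ⟩
        0#                     ∎))
      -- then (x - k x') P vanishes
      x≈kx' : x ≈ k * x'
      x≈kx' = x∙y⁻¹≈ε⇒x≈y _ _ (nonzero-annihilated P≢0 λ i → begin
        (x - k * x') * P i
          ≈⟨ solve 7 (λ x x' y y' k p t → (x :- k :* x') :* p
                := ((x :* p :+ y :* t) :- k :* (x' :* p :+ y' :* t)) :+ (k :* y' :- y) :* t)
              refl x x' y y' k (P i) (T i) ⟩
        ((x * P i + y * T i) - k * (x' * P i + y' * T i)) + (k * y' - y) * T i
          ≈⟨ +-cong (x≈y⇒x∙y⁻¹≈ε (pt≋kpt' i)) (trans (*-congʳ (x≈y⇒x∙y⁻¹≈ε (sym y≈ky'))) (zeroˡ _)) ⟩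
        0# + 0#
          ≈⟨ +-identityʳ 0# ⟩
        0# ∎)

    -- an elliptic quadric does not meet L: λ (τ X₄)² = (μ ξ)² would make λ a square
    elliptic : ∀ λ' → Elliptic λ' → External L (Q λ')
    elliptic λ' nonsquare = not-contained λ' , λ w w≢0 w-on w∈Q →
      let (ξ , _ , equation , w₄≉0) = on-Q λ' w≢0 w-on (lower w∈Q) in
      nonsquare (square-quotient equation (*-nonzero T∉π w₄≉0))

    -- a hyperbolic quadric Q_{κ²} meets L exactly in the points (κτ : μ) and (κτ : -μ)
    hyperbolic : ¬ two ≈ 0# → ∀ λ' → Hyperbolic λ' → Secant L (Q λ')
    hyperbolic 2≉0 λ' (λ'≉0 , κ , λ'≈κκ) =
      not-contained λ' ,
      pt κτ μ , pt κτ (- μ) ,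
      pt-nonzero μ≉0 , pt-on κτ μ , lift (on-Q-at μ refl) ,
      pt-nonzero -μ≉0 , pt-on κτ (- μ) , lift (on-Q-at (- μ) -μ²≈μ²) ,
      distinct , only-these
      where
      κτ : Carrier
      κτ = κ * τ

      κ≉0 : ¬ κ ≈ 0#
      κ≉0 κ≈0 = λ'≉0 (trans λ'≈κκ (*-zeroʳ κ κ≈0))

      -μ≉0 : ¬ - μ ≈ 0#
      -μ≉0 -μ≈0 = μ≉0 (trans (sym (-‿involutive μ)) (trans (-‿cong -μ≈0) -0#≈0#))

      -μ²≈μ² : - μ * - μ ≈ μ * μ
      -μ²≈μ² = solve 1 (λ μ → (:- μ) :* (:- μ) := μ :* μ) refl μ

      on-Q-at : ∀ ν → ν * ν ≈ μ * μ → form λ' (pt κτ ν) ≈ 0#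
      on-Q-at ν νν≈μμ = begin
        form λ' (pt κτ ν)                                      ≈⟨ pt-form λ' κτ ν ⟩
        λ' * ((τ * ν) * (τ * ν)) - (μ * κτ) * (μ * κτ)          ≈⟨ +-congʳ (*-congʳ λ'≈κκ) ⟩
        κ * κ * ((τ * ν) * (τ * ν)) - (μ * κτ) * (μ * κτ)       ≈⟨ solve 4 (λ κ τ ν μ →
            κ :* κ :* ((τ :* ν) :* (τ :* ν)) :- (μ :* (κ :* τ)) :* (μ :* (κ :* τ))
            := (κ :* τ) :* (κ :* τ) :* (ν :* ν :- μ :* μ)) refl κ τ ν μ ⟩
        κτ * κτ * (ν * ν - μ * μ)                               ≈⟨ *-zeroʳ _ (x≈y⇒x∙y⁻¹≈ε νν≈μμ) ⟩
        0#                                                      ∎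

      -- the points coincide only if 2 κ τ μ = 0
      distinct : ¬ SamePoint (pt κτ μ) (pt κτ (- μ))
      distinct same = 2≉0 (cancel (*-nonzero (*-nonzero κ≉0 T∉π) μ≉0) (begin
        κτ * μ * two             ≈⟨ solve 2 (λ a μ → a :* μ :* con (+ 2) := a :* μ :- a :* (:- μ)) refl κτ μ ⟩
        κτ * μ - κτ * (- μ)      ≈⟨ x≈y⇒x∙y⁻¹≈ε (sym (samePoint⇒proportional same)) ⟩
        0#                       ∎))

      squares : ∀ {w ξ} → λ' * ((τ * x4 w) * (τ * x4 w)) ≈ (μ * ξ) * (μ * ξ) →
                (κτ * x4 w) * (κτ * x4 w) ≈ (μ * ξ) * (μ * ξ)
      squares {w} {ξ} equation = begin
        (κτ * x4 w) * (κτ * x4 w)           ≈⟨ solve 3 (λ κ τ w₄ → (κ :* τ :* w₄) :* (κ :* τ :* w₄)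
                                                  := κ :* κ :* ((τ :* w₄) :* (τ :* w₄))) refl κ τ (x4 w) ⟩
        κ * κ * ((τ * x4 w) * (τ * x4 w))   ≈⟨ *-congʳ λ'≈κκ ⟨
        λ' * ((τ * x4 w) * (τ * x4 w))      ≈⟨ equation ⟩
        (μ * ξ) * (μ * ξ)                   ∎

      root⇒samePoint : ∀ {w ξ ν} → ¬ ν ≈ 0# → SamePoint w (pt ξ (x4 w)) → ¬ x4 w ≈ 0# →
                       κτ * x4 w ≈ ν * ξ → SamePoint w (pt κτ ν)
      root⇒samePoint {w} {ξ} {ν} ν≉0 w~pt w₄≉0 root =
        samePoint-trans w~pt (pt-samePoint (trans (*-comm ξ ν) (sym root)) w₄≉0 ν≉0)

      only-these : ∀ w → NonZero w → OnLine L w → Q λ' w →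
                   SamePoint w (pt κτ μ) ⊎ SamePoint w (pt κτ (- μ))
      only-these w w≢0 w-on (lift w∈Q) =
        let (ξ , w~pt , equation , w₄≉0) = on-Q λ' w≢0 w-on w∈Q in
        ⊎-map (root⇒samePoint μ≉0 w~pt w₄≉0)
                     (λ -root → root⇒samePoint -μ≉0 w~pt w₄≉0 (trans -root (-‿distribˡ-* μ ξ)))
                     (equal-squares (squares {w} {ξ} equation))

  -- A line L of L₄ meets π in a point P ∉ C lying on a tangent L₁ of C, and
  -- touches Q₀ at a point T ∉ π; P is conjugate to T and to the contact point
  -- of L₁, so Q₀(P) = -μ² and the Transversal analysis applies.
  L₄-lines : ¬ two ≈ 0# → ∀ L → L4 L →
    (∀ λ' → Hyperbolic λ' → Secant L (Q λ')) × (∀ λ' → Elliptic λ' → External L (Q λ'))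
  L₄-lines 2≉0 L ((_ , T , T≢0 , T-on , lift T∈Q₀ , only-T) , _ , (P , P≢0 , P-on , lift P∈π , only-P) , L∩π⊆E)
    with L∩π⊆E P P≢0 P-on (lift P∈π)
  ... | _ , P∉C , L₁ , _ , (L₁⊆π , _ , T₁ , _ , T₁-on , T₁∈C , only-T₁) , _ , P-on-L₁ , _ =
    Transversal.hyperbolic L P T μ only-P P-on P∈π T-on T∉π Q₀[P]+μ² μ≉0 P⊥T T∈Q₀ 2≉0 ,
    Transversal.elliptic L P T μ only-P P-on P∈π T-on T∉π Q₀[P]+μ² μ≉0 P⊥T T∈Q₀
    where
    -- the points of π on Q₀ are those of C
    P∉Q₀ : ¬ form 0# P ≈ 0#
    P∉Q₀ P∈Q₀ = P∉C (π∩Q₀⊆C P≢0 P∈π P∈Q₀)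

    -- L₁ lies in π, so T₁ is its only point on Q₀
    P⊥T₁ : polar 0# P T₁ ≈ 0#
    P⊥T₁ = tangent⇒conjugate {L₁} {0#} {T₁} {P}
      (λ w w≢0 w-on w∈Q₀ → only-T₁ w w≢0 w-on (π∩Q₀⊆C w≢0 (lower (L₁⊆π w w≢0 w-on)) w∈Q₀))
      T₁-on (C⊆Q₀ T₁∈C) P-on-L₁ P∉Q₀

    μ : Carrier
    μ = proj₁ (conjugate-to-C {P} {T₁} T₁∈C P⊥T₁)

    Q₀[P]+μ² : form 0# P + μ * μ ≈ 0#
    Q₀[P]+μ² = proj₂ (conjugate-to-C {P} {T₁} T₁∈C P⊥T₁)

    μ≉0 : ¬ μ ≈ 0#
    μ≉0 μ≈0 = P∉Q₀ (trans (sym (+-identityʳ _)) (trans (+-congˡ (sym (*-zeroʳ μ μ≈0))) Q₀[P]+μ²))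

    -- L is tangent to Q₀ at T
    P⊥T : polar 0# P T ≈ 0#
    P⊥T = tangent⇒conjugate {L} {0#} {T} {P} (λ w w≢0 w-on w∈Q₀ → only-T w w≢0 w-on (lift w∈Q₀)) T-on T∈Q₀ P-on P∉Q₀

    -- T ∈ π would make T the point P, which is off Q₀
    T∉π : ¬ x4 T ≈ 0#
    T∉π T₄≈0 = P∉Q₀ (samePoint-form 0# {T} {P} (only-P T T≢0 T-on (lift T₄≈0)) T∈Q₀)

corollary2 : {c ℓ : Level} (R : CommutativeRing c ℓ) → IsField R →
    (q : ℕ) → OddPrimePower q → HasCard R q →
    ((L : Geometry.Line R) → Geometry.L4 R L →
        (∀ λ' → Geometry.Hyperbolic R λ' → Geometry.Secant R L (Geometry.Q R λ')) ×
        (∀ λ' → Geometry.Elliptic R λ' → Geometry.External R L (Geometry.Q R λ'))) ×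
    ((L : Geometry.Line R) → Geometry.L4' R L →
        ∀ λ' → Geometry.Secant R L (Geometry.Q R λ'))
corollary2 R F q odd card =
  Quadrics.L₄-lines R F _≟_ (1+1≉0 odd) ,
  λ L L∈L₄' → proj₁ L∈L₄'
  where open FiniteField R F card
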